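{- Let $d:m\to 0$ be a diagram in pre-normal form with representing $n\times m$ Boolean matrix $A$, and let $\Phi(d)$ be the set of $\neg$-clauses over $\{x_1,\dots,x_m\}$ generated by $d$. Then $[\![d]\!]$ (identified with a subset of $\mathbb{B}^m$) is exactly the set of satisfying assignments of $\Phi(d)$.
   Context: $\mathbb{B}=\{0,1\}$. Diagrams are built from the generators copy $1\to2$, discard $1\to0$, conjunction $2\to1$, unit $0\to1$, counit $1\to0$ (among others), identities and symmetries, by sequential and parallel composition. Interpretation $[\![\cdot]\!]$ as relations: copy $=\{(x,(y_1,y_2))\mid x\le y_1,x\le y_2\}$, discard $=\{(x,\bullet)\mid x\in\mathbb{B}\}$, conjunction $=\{((x_1,x_2),y)\mid x_1\land x_2\le y\}$, unit $=\{(\bullet,1)\}$, counit $=\{(0,\bullet)\}$, identity $=\{(x,y)\mid x\le y\}$, symmetry swaps coordinates (up to the order); sequential composition is relational composition, parallel composition is the product of relations. A matrix diagram $m\to n$ is $c_1;c_2$ where $c_1$ is built only from copy, discard, identities, symmetries and $c_2$ only from conjunction, unit, identities, symmetries; its representing $n\times m$ matrix $A$ has $A_{ij}=1$ iff the $j$-th left wire is connected (via a path of wires through the nodes) to the $i$-th right wire. A diagram $d:m\to0$ is in pre-normal form if $d=d_1;(\text{counit})^{\otimes n}$ with $d_1:m\to n$ a matrix diagram; its representing matrix is that of $d_1$. A $\neg$-clause over $\mathit{Var}$ is a subset of $\mathit{Var}$; $\mathbf{s}\in\mathbb{B}^m$ satisfies $\varphi$ if $\bigwedge_{x_j\in\varphi}\mathbf{s}_j=0$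 (the empty clause is satisfied by nothing), and a set of clauses if it satisfies all of them. $\Phi(d)$ is the set of $\neg$-clauses $\{x_j\mid A_{ij}=1\}$ for $i=1,\dots,n$ (one per row of $A$). -}

module Defs where

open import Data.Nat using (ℕ; zero; suc; _+_)
open import Data.Bool using (Bool; true; false; _∧_; _≤_)
open import Data.Fin using (Fin; zero; suc; splitAt; _↑ˡ_; _↑ʳ_; _≟_)
open import Data.Fin.Subset using (Subset; Side; inside; outside)
open import Data.Vec using (Vec; []; _∷_; take; drop; tabulate)
open import Data.Sum using (inj₁; inj₂)
open import Data.Product using (_×_; ∃)
open import Data.Unit using (⊤)
open import Data.List using (allFin)
open import Data.Bool.ListAction using (any)
open import Relation.Binary.PropositionalEquality using (_≡_)
open import Relation.Nullary.Decidable using (⌊_⌋)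

infixr 5 _⨾_
infixr 6 _⊗_

data Diag : ℕ → ℕ → Set where
  copy    : Diag 1 2
  discard : Diag 1 0
  conj    : Diag 2 1
  unit    : Diag 0 1
  counit  : Diag 1 0
  idw     : Diag 1 1
  sym     : Diag 2 2
  empty   : Diag 0 0
  _⨾_     : ∀ {a b c} → Diag a b → Diag b c → Diag a c
  _⊗_     : ∀ {a b c d} → Diag a b → Diag c d → Diag (a + c) (b + d)

Rel : ℕ → ℕ → Set₁
Rel m n = Vec Bool m → Vec Bool n → Set

⟦_⟧ : ∀ {m n} → Diag m n → Rel m n
⟦ copy ⟧ (x ∷ []) (y₁ ∷ y₂ ∷ []) = (x ≤ y₁) × (x ≤ y₂)
⟦ discard ⟧ _ _ = ⊤
⟦ conj ⟧ (x₁ ∷ x₂ ∷ []) (y ∷ []) = (x₁ ∧ x₂) ≤ y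
⟦ unit ⟧ [] (y ∷ []) = y ≡ true
⟦ counit ⟧ (x ∷ []) [] = x ≡ false
⟦ idw ⟧ (x ∷ []) (y ∷ []) = x ≤ y
⟦ sym ⟧ (x₁ ∷ x₂ ∷ []) (y₁ ∷ y₂ ∷ []) = (x₁ ≤ y₂) × (x₂ ≤ y₁)
⟦ empty ⟧ _ _ = ⊤
⟦ d ⨾ e ⟧ x y = ∃ λ z → ⟦ d ⟧ x z × ⟦ e ⟧ z y
⟦ _⊗_ {a} {b} d e ⟧ x y = ⟦ d ⟧ (take a x) (take b y) × ⟦ e ⟧ (drop a x) (drop b y)

data CopyD : ℕ → ℕ → Set where
  copy    : CopyD 1 2
  discard : CopyD 1 0
  idw     : CopyD 1 1
  sym     : CopyD 2 2
  empty   : CopyD 0 0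
  _⨾_     : ∀ {a b c} → CopyD a b → CopyD b c → CopyD a c
  _⊗_     : ∀ {a b c d} → CopyD a b → CopyD c d → CopyD (a + c) (b + d)

data ConjD : ℕ → ℕ → Set where
  conj  : ConjD 2 1
  unit  : ConjD 0 1
  idw   : ConjD 1 1
  sym   : ConjD 2 2
  empty : ConjD 0 0
  _⨾_   : ∀ {a b c} → ConjD a b → ConjD b c → ConjD a c
  _⊗_   : ∀ {a b c d} → ConjD a b → ConjD c d → ConjD (a + c) (b + d)

embCopy : ∀ {m n} → CopyD m n → Diag m n
embCopy copy = copy
embCopy discard = discard
embCopy idw = idw
embCopy sym = sym
embCopy empty = empty
embCopy (c ⨾ d) = embCopy c ⨾ embCopy d
embCopy (c ⊗ d) = embCopy c ⊗ embCopy d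

embConj : ∀ {m n} → ConjD m n → Diag m n
embConj conj = conj
embConj unit = unit
embConj idw = idw
embConj sym = sym
embConj empty = empty
embConj (c ⨾ d) = embConj c ⨾ embConj d
embConj (c ⊗ d) = embConj c ⊗ embConj d

counits : (n : ℕ) → Diag n 0
counits zero = empty
counits (suc n) = counit ⊗ counits n

preNormal : ∀ {m k n} → CopyD m k → ConjD k n → Diag m 0
preNormal {n = n} c₁ c₂ = (embCopy c₁ ⨾ embConj c₂) ⨾ counits n

-- In a copy-part diagram every right wire is connected
-- to exactly one left wire (its source); in a conjunction-part diagram every
-- left wire is connected to exactly one right wire (its target).

src : ∀ {m k} → CopyD m k → Fin k → Fin m
src copy _ = zero
src discard ()
src idw w = w
src sym zero = suc zero
src sym (suc zero) = zero
src empty ()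
src (c ⨾ d) w = src c (src d w)
src (_⊗_ {a} {b} {c} c₁ c₂) w with splitAt b w
... | inj₁ u = src c₁ u ↑ˡ c
... | inj₂ u = a ↑ʳ src c₂ u

tgt : ∀ {k n} → ConjD k n → Fin k → Fin n
tgt conj _ = zero
tgt unit ()
tgt idw w = w
tgt sym zero = suc zero
tgt sym (suc zero) = zero
tgt empty ()
tgt (c ⨾ d) w = tgt d (tgt c w)
tgt (_⊗_ {a} {b} {c} {d} c₁ c₂) w with splitAt a w
... | inj₁ u = tgt c₁ u ↑ˡ d
... | inj₂ u = b ↑ʳ tgt c₂ u

-- Representing n × m matrix of the matrix diagram c₁ ; c₂ :
-- A i j = true iff left wire j is connected to right wire i, i.e. some
-- middle wire w has source j (in c₁) and target i (in c₂).
matrix : ∀ {m k n} → CopyD m k → ConjD k n → Fin n → Fin m → Bool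
matrix {k = k} c₁ c₂ i j =
  any (λ w → ⌊ src c₁ w ≟ j ⌋ ∧ ⌊ tgt c₂ w ≟ i ⌋) (allFin k)

-- ¬-clauses over Var = {x₁,…,x_m}: subsets of Fin m.

Clause : ℕ → Set
Clause m = Subset m

bigAnd : ∀ {m} → Clause m → Vec Bool m → Bool
bigAnd [] [] = true
bigAnd (inside ∷ φ) (x ∷ s) = x ∧ bigAnd φ s
bigAnd (outside ∷ φ) (x ∷ s) = bigAnd φ s

Satisfies : ∀ {m} → Vec Bool m → Clause m → Set
Satisfies s φ = bigAnd φ s ≡ false

Φ : ∀ {m n} → (Fin n → Fin m → Bool) → Fin n → Clause m
Φ A i = tabulate (λ j → toSide (A i j))
  where
  toSide : Bool → Side
  toSide true = inside
  toSide false = outside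

SatisfiesAll : ∀ {m n} → Vec Bool m → (Fin n → Clause m) → Set
SatisfiesAll s Φs = ∀ i → Satisfies s (Φs i)

{-# OPTIONS --safe #-}
-- Both halves of a matrix diagram have a closed-form semantics read off from its wiring:
-- the copy part relates s to z iff z_w ≥ s_(src w) for every middle wire w, and the
-- conjunction part relates z to y iff y_i = 1 whenever every wire entering node i carries 1.
-- The counits force y = 0, so a suitable z exists iff no node has all inputs equal to 1,
-- and by monotonicity it suffices to test the least choice z = s ∘ src. Finally, node i has
-- all inputs 1 on s ∘ src iff s_j = 1 for every x_j connected to it, i.e. iff s violates
-- the i-th clause.
module Submission where

open import Defs
open import Data.Nat using (ℕ; zero; suc; _+_)
open import Data.Bool using (Bool; true; false; _∧_; _≤_; b≤b; f≤t)
open import Data.Bool.Properties using (T-≡; T-∧)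
import Data.Bool.Properties as Bool
open import Data.Vec using (Vec; []; _∷_; lookup; take; drop; tabulate; replicate)
open import Data.Vec.Properties using (lookup∘tabulate)
open import Data.Fin using (Fin; zero; suc; _↑ˡ_; _↑ʳ_; _≟_)
open import Data.Fin.Properties using (splitAt-↑ˡ; splitAt-↑ʳ; ↑ˡ-injective; ↑ʳ-injective; suc-injective; all?)
open import Data.Fin.Subset using (inside; outside)
open import Data.Product using (_×_; _,_; ∃; proj₁; proj₂)
open import Data.Unit using (tt)
open import Data.Empty using (⊥-elim)
open import Data.List using (allFin)
open import Data.List.Relation.Unary.Any using (satisfied)
open import Data.List.Relation.Unary.Any.Properties using (any⁺; any⁻)
open import Data.List.Membership.Propositional using (lose)
open import Data.List.Membership.Propositional.Properties using (∈-allFin)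
open import Relation.Binary.PropositionalEquality using (_≡_; _≢_; refl; trans; cong; cong₂; subst) renaming (sym to ≡-sym)
open import Relation.Nullary using (Dec; yes; does; _→-dec_)
open import Relation.Nullary.Decidable using (⌊_⌋; dec-true; toWitness; fromWitness)
open import Function using (_∘_; id)
open import Function.Bundles using (_⇔_; mk⇔; Equivalence)

open Equivalence

≤-true : ∀ {x y} → x ≤ y → x ≡ true → y ≡ true
≤-true b≤b x≡true = x≡true
≤-true f≤t _      = refl

true⇒≤ : ∀ x y → (x ≡ true → y ≡ true) → x ≤ y
true⇒≤ false false _ = b≤b
true⇒≤ false true  _ = f≤t
true⇒≤ true  y     f with f refl
... | refl = b≤b

∧-true⇔ : ∀ {x y} → x ∧ y ≡ true ⇔ (x ≡ true × y ≡ true)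
∧-true⇔ {true}  {true}  = mk⇔ (λ _ → refl , refl) (λ _ → refl)
∧-true⇔ {true}  {false} = mk⇔ (λ ()) proj₂
∧-true⇔ {false}         = mk⇔ (λ ()) proj₁

↑-elim : ∀ {b d} (P : Fin (b + d) → Set) →
         (∀ u → P (u ↑ˡ d)) → (∀ u → P (b ↑ʳ u)) → ∀ w → P w
↑-elim {zero}  P left right w       = right w
↑-elim {suc b} P left right zero    = left zero
↑-elim {suc b} P left right (suc w) = ↑-elim (P ∘ suc) (left ∘ suc) right w

↑ˡ≢↑ʳ : ∀ {b d} (u : Fin b) (v : Fin d) → u ↑ˡ d ≢ b ↑ʳ v
↑ˡ≢↑ʳ zero    v ()
↑ˡ≢↑ʳ (suc u) v eq = ↑ˡ≢↑ʳ u v (suc-injective eq)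

lookup-take : ∀ {A : Set} a {c} (x : Vec A (a + c)) (u : Fin a) →
              lookup (take a x) u ≡ lookup x (u ↑ˡ c)
lookup-take (suc a) (y ∷ x) zero    = refl
lookup-take (suc a) (y ∷ x) (suc u) = lookup-take a x u

lookup-drop : ∀ {A : Set} a {c} (x : Vec A (a + c)) (u : Fin c) →
              lookup (drop a x) u ≡ lookup x (a ↑ʳ u)
lookup-drop zero    x       u = refl
lookup-drop (suc a) (y ∷ x) u = lookup-drop a x u

module _ {a b c d : ℕ} where

  src-⊗-↑ˡ : (c₁ : CopyD a b) (c₂ : CopyD c d) (u : Fin b) → src (c₁ ⊗ c₂) (u ↑ˡ d) ≡ src c₁ u ↑ˡ c
  src-⊗-↑ˡ c₁ c₂ u rewrite splitAt-↑ˡ b u d = refl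

  src-⊗-↑ʳ : (c₁ : CopyD a b) (c₂ : CopyD c d) (u : Fin d) → src (c₁ ⊗ c₂) (b ↑ʳ u) ≡ a ↑ʳ src c₂ u
  src-⊗-↑ʳ c₁ c₂ u rewrite splitAt-↑ʳ b d u = refl

  tgt-⊗-↑ˡ : (c₁ : ConjD a b) (c₂ : ConjD c d) (u : Fin a) → tgt (c₁ ⊗ c₂) (u ↑ˡ c) ≡ tgt c₁ u ↑ˡ d
  tgt-⊗-↑ˡ c₁ c₂ u rewrite splitAt-↑ˡ a u c = refl

  tgt-⊗-↑ʳ : (c₁ : ConjD a b) (c₂ : ConjD c d) (u : Fin c) → tgt (c₁ ⊗ c₂) (a ↑ʳ u) ≡ b ↑ʳ tgt c₂ u
  tgt-⊗-↑ʳ c₁ c₂ u rewrite splitAt-↑ʳ a c u = refl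

CopyRel : ∀ {m k} → CopyD m k → Vec Bool m → Vec Bool k → Set
CopyRel c s z = ∀ w → lookup s (src c w) ≤ lookup z w

pull : ∀ {m k} → CopyD m k → Vec Bool m → Vec Bool k
pull c s = tabulate (lookup s ∘ src c)

lookup-pull : ∀ {m k} (c : CopyD m k) s w → lookup (pull c s) w ≡ lookup s (src c w)
lookup-pull c s = lookup∘tabulate (lookup s ∘ src c)

copyRel-pull : ∀ {m k} (c : CopyD m k) s → CopyRel c s (pull c s)
copyRel-pull c s w = Bool.≤-reflexive (≡-sym (lookup-pull c s w))

copyRel-⊗ : ∀ {a b c d} (c₁ : CopyD a b) (c₂ : CopyD c d) s z →
            CopyRel (c₁ ⊗ c₂) s z ⇔ (CopyRel c₁ (take a s) (take b z) × CopyRel c₂ (drop a s) (drop b z))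
copyRel-⊗ {a} {b} {c} {d} c₁ c₂ s z = mk⇔
  (λ R → (λ u → subst id (≡-sym (left u)) (R (u ↑ˡ d))) , (λ u → subst id (≡-sym (right u)) (R (b ↑ʳ u))))
  (λ (R₁ , R₂) → ↑-elim _ (λ u → subst id (left u) (R₁ u)) (λ u → subst id (right u) (R₂ u)))
  where
  left : ∀ u → (lookup (take a s) (src c₁ u) ≤ lookup (take b z) u)
             ≡ (lookup s (src (c₁ ⊗ c₂) (u ↑ˡ d)) ≤ lookup z (u ↑ˡ d))
  left u = cong₂ _≤_ (trans (lookup-take a s (src c₁ u)) (cong (lookup s) (≡-sym (src-⊗-↑ˡ c₁ c₂ u))))
                     (lookup-take b z u)
  right : ∀ u → (lookup (drop a s) (src c₂ u) ≤ lookup (drop b z) u)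
              ≡ (lookup s (src (c₁ ⊗ c₂) (b ↑ʳ u)) ≤ lookup z (b ↑ʳ u))
  right u = cong₂ _≤_ (trans (lookup-drop a s (src c₂ u)) (cong (lookup s) (≡-sym (src-⊗-↑ʳ c₁ c₂ u))))
                      (lookup-drop b z u)

⟦embCopy⟧⇒copyRel : ∀ {m k} (c : CopyD m k) {s z} → ⟦ embCopy c ⟧ s z → CopyRel c s z
⟦embCopy⟧⇒copyRel copy    {_ ∷ []} {_ ∷ _ ∷ []} (p , q) zero       = p
⟦embCopy⟧⇒copyRel copy    {_ ∷ []} {_ ∷ _ ∷ []} (p , q) (suc zero) = q
⟦embCopy⟧⇒copyRel idw     {_ ∷ []} {_ ∷ []}     p       zero       = p
⟦embCopy⟧⇒copyRel sym     {_ ∷ _ ∷ []} {_ ∷ _ ∷ []} (p , q) zero       = q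
⟦embCopy⟧⇒copyRel sym     {_ ∷ _ ∷ []} {_ ∷ _ ∷ []} (p , q) (suc zero) = p
⟦embCopy⟧⇒copyRel (c ⨾ e) (z , p , q) w =
  Bool.≤-trans (⟦embCopy⟧⇒copyRel c p (src e w)) (⟦embCopy⟧⇒copyRel e q w)
⟦embCopy⟧⇒copyRel (c₁ ⊗ c₂) {s} {z} (p , q) =
  from (copyRel-⊗ c₁ c₂ s z) (⟦embCopy⟧⇒copyRel c₁ p , ⟦embCopy⟧⇒copyRel c₂ q)

copyRel⇒⟦embCopy⟧ : ∀ {m k} (c : CopyD m k) {s z} → CopyRel c s z → ⟦ embCopy c ⟧ s z
copyRel⇒⟦embCopy⟧ copy    {_ ∷ []} {_ ∷ _ ∷ []} R = R zero , R (suc zero)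
copyRel⇒⟦embCopy⟧ discard R = tt
copyRel⇒⟦embCopy⟧ idw     {_ ∷ []} {_ ∷ []} R = R zero
copyRel⇒⟦embCopy⟧ sym     {_ ∷ _ ∷ []} {_ ∷ _ ∷ []} R = R (suc zero) , R zero
copyRel⇒⟦embCopy⟧ empty   R = tt
copyRel⇒⟦embCopy⟧ (c ⨾ e) {s} {z} R =
  pull c s , copyRel⇒⟦embCopy⟧ c (copyRel-pull c s) , copyRel⇒⟦embCopy⟧ e pulled≤z
  where
  pulled≤z : CopyRel e (pull c s) z
  pulled≤z w = subst (_≤ lookup z w) (≡-sym (lookup-pull c s (src e w))) (R w)
copyRel⇒⟦embCopy⟧ (c₁ ⊗ c₂) {s} {z} R =
  let R₁ , R₂ = to (copyRel-⊗ c₁ c₂ s z) R in copyRel⇒⟦embCopy⟧ c₁ R₁ , copyRel⇒⟦embCopy⟧ c₂ R₂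

InputsTrue : ∀ {k n} → ConjD k n → (Fin k → Bool) → Fin n → Set
InputsTrue c f i = ∀ w → tgt c w ≡ i → f w ≡ true

inputsTrue-mono : ∀ {k n} (c : ConjD k n) {f g : Fin k → Bool} {i} →
                  (∀ w → f w ≤ g w) → InputsTrue c f i → InputsTrue c g i
inputsTrue-mono c f≤g H w tgt≡i = ≤-true (f≤g w) (H w tgt≡i)

ConjRel : ∀ {k n} → ConjD k n → Vec Bool k → Vec Bool n → Set
ConjRel c z y = ∀ i → InputsTrue c (lookup z) i → lookup y i ≡ true

inputsTrue? : ∀ {k n} (c : ConjD k n) f i → Dec (InputsTrue c f i)
inputsTrue? c f i = all? λ w → (tgt c w ≟ i) →-dec (f w Bool.≟ true)

does-true⇒ : ∀ {A : Set} (a? : Dec A) → does a? ≡ true → A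
does-true⇒ (yes a) _ = a

push : ∀ {k n} → ConjD k n → Vec Bool k → Vec Bool n
push c z = tabulate (does ∘ inputsTrue? c (lookup z))

push⇔inputsTrue : ∀ {k n} (c : ConjD k n) z i → lookup (push c z) i ≡ true ⇔ InputsTrue c (lookup z) i
push⇔inputsTrue c z i = mk⇔
  (λ e → does-true⇒ (inputsTrue? c (lookup z) i) (trans (≡-sym (lookup∘tabulate _ i)) e))
  (λ H → trans (lookup∘tabulate _ i) (dec-true (inputsTrue? c (lookup z) i) H))

module _ {a b c d} (c₁ : ConjD a b) (c₂ : ConjD c d) (z : Vec Bool (a + c)) where

  inputsTrue-⊗-↑ˡ : ∀ i → InputsTrue (c₁ ⊗ c₂) (lookup z) (i ↑ˡ d) ⇔ InputsTrue c₁ (lookup (take a z)) i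
  inputsTrue-⊗-↑ˡ i = mk⇔
    (λ H w tgt≡i → trans (lookup-take a z w) (H (w ↑ˡ c) (trans (tgt-⊗-↑ˡ c₁ c₂ w) (cong (_↑ˡ d) tgt≡i))))
    (λ H → ↑-elim _
      (λ w tgt≡i → trans (≡-sym (lookup-take a z w))
                         (H w (↑ˡ-injective d _ _ (trans (≡-sym (tgt-⊗-↑ˡ c₁ c₂ w)) tgt≡i))))
      (λ w tgt≡i → ⊥-elim (↑ˡ≢↑ʳ i (tgt c₂ w) (trans (≡-sym tgt≡i) (tgt-⊗-↑ʳ c₁ c₂ w)))))

  inputsTrue-⊗-↑ʳ : ∀ i → InputsTrue (c₁ ⊗ c₂) (lookup z) (b ↑ʳ i) ⇔ InputsTrue c₂ (lookup (drop a z)) i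
  inputsTrue-⊗-↑ʳ i = mk⇔
    (λ H w tgt≡i → trans (lookup-drop a z w) (H (a ↑ʳ w) (trans (tgt-⊗-↑ʳ c₁ c₂ w) (cong (b ↑ʳ_) tgt≡i))))
    (λ H → ↑-elim _
      (λ w tgt≡i → ⊥-elim (↑ˡ≢↑ʳ (tgt c₁ w) i (trans (≡-sym (tgt-⊗-↑ˡ c₁ c₂ w)) tgt≡i)))
      (λ w tgt≡i → trans (≡-sym (lookup-drop a z w))
                         (H w (↑ʳ-injective b _ _ (trans (≡-sym (tgt-⊗-↑ʳ c₁ c₂ w)) tgt≡i)))))

  conjRel-⊗ : ∀ y → ConjRel (c₁ ⊗ c₂) z y ⇔ (ConjRel c₁ (take a z) (take b y) × ConjRel c₂ (drop a z) (drop b y))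
  conjRel-⊗ y = mk⇔
    (λ R → (λ i H → trans (lookup-take b y i) (R (i ↑ˡ d) (from (inputsTrue-⊗-↑ˡ i) H)))
         , (λ i H → trans (lookup-drop b y i) (R (b ↑ʳ i) (from (inputsTrue-⊗-↑ʳ i) H))))
    (λ (R₁ , R₂) → ↑-elim _
      (λ i H → trans (≡-sym (lookup-take b y i)) (R₁ i (to (inputsTrue-⊗-↑ˡ i) H)))
      (λ i H → trans (≡-sym (lookup-drop b y i)) (R₂ i (to (inputsTrue-⊗-↑ʳ i) H))))

⟦embConj⟧⇒conjRel : ∀ {k n} (c : ConjD k n) {z y} → ⟦ embConj c ⟧ z y → ConjRel c z y
⟦embConj⟧⇒conjRel conj {x₁ ∷ x₂ ∷ []} {_ ∷ []} x₁∧x₂≤y zero H =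
  ≤-true x₁∧x₂≤y (from ∧-true⇔ (H zero refl , H (suc zero) refl))
⟦embConj⟧⇒conjRel unit {[]} {_ ∷ []} y≡true zero H = y≡true
⟦embConj⟧⇒conjRel idw {_ ∷ []} {_ ∷ []} x≤y zero H = ≤-true x≤y (H zero refl)
⟦embConj⟧⇒conjRel sym {_ ∷ _ ∷ []} {_ ∷ _ ∷ []} (p , q) zero       H = ≤-true q (H (suc zero) refl)
⟦embConj⟧⇒conjRel sym {_ ∷ _ ∷ []} {_ ∷ _ ∷ []} (p , q) (suc zero) H = ≤-true p (H zero refl)
⟦embConj⟧⇒conjRel (c ⨾ e) (x , p , q) i H =
  ⟦embConj⟧⇒conjRel e q i λ u tgt≡i →
    ⟦embConj⟧⇒conjRel c p u λ w tgt≡u → H w (trans (cong (tgt e) tgt≡u) tgt≡i)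
⟦embConj⟧⇒conjRel (c₁ ⊗ c₂) {z} {y} (p , q) =
  from (conjRel-⊗ c₁ c₂ z y) (⟦embConj⟧⇒conjRel c₁ p , ⟦embConj⟧⇒conjRel c₂ q)

conjRel⇒⟦embConj⟧ : ∀ {k n} (c : ConjD k n) {z y} → ConjRel c z y → ⟦ embConj c ⟧ z y
conjRel⇒⟦embConj⟧ conj {x₁ ∷ x₂ ∷ []} {y ∷ []} R = true⇒≤ (x₁ ∧ x₂) y λ x₁∧x₂≡true →
  let x₁≡true , x₂≡true = to ∧-true⇔ x₁∧x₂≡true
  in R zero λ { zero _ → x₁≡true ; (suc zero) _ → x₂≡true }
conjRel⇒⟦embConj⟧ unit {[]} {_ ∷ []} R = R zero λ ()
conjRel⇒⟦embConj⟧ idw {x ∷ []} {y ∷ []} R = true⇒≤ x y λ x≡true → R zero λ { zero _ → x≡true }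
conjRel⇒⟦embConj⟧ sym {x₁ ∷ x₂ ∷ []} {y₁ ∷ y₂ ∷ []} R =
  true⇒≤ x₁ y₂ (λ x₁≡true → R (suc zero) λ { zero _ → x₁≡true ; (suc zero) () }) ,
  true⇒≤ x₂ y₁ (λ x₂≡true → R zero λ { zero () ; (suc zero) _ → x₂≡true })
conjRel⇒⟦embConj⟧ empty R = tt
conjRel⇒⟦embConj⟧ (c ⨾ e) {z} {y} R = push c z , conjRel⇒⟦embConj⟧ c pushed , conjRel⇒⟦embConj⟧ e pushed→y
  where
  pushed : ConjRel c z (push c z)
  pushed u = from (push⇔inputsTrue c z u)
  pushed→y : ConjRel e (push c z) y
  pushed→y i H = R i λ w tgt≡i → to (push⇔inputsTrue c z (tgt c w)) (H (tgt c w) tgt≡i) w refl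
conjRel⇒⟦embConj⟧ (c₁ ⊗ c₂) {z} {y} R =
  let R₁ , R₂ = to (conjRel-⊗ c₁ c₂ z y) R in conjRel⇒⟦embConj⟧ c₁ R₁ , conjRel⇒⟦embConj⟧ c₂ R₂

⟦counits⟧⇒false : ∀ n {z} → ⟦ counits n ⟧ z [] → ∀ i → lookup z i ≡ false
⟦counits⟧⇒false (suc n) {_ ∷ _} (x≡false , _) zero    = x≡false
⟦counits⟧⇒false (suc n) {_ ∷ _} (_ , rest)    (suc i) = ⟦counits⟧⇒false n rest i

⟦counits⟧-replicate : ∀ n → ⟦ counits n ⟧ (replicate n false) []
⟦counits⟧-replicate zero    = tt
⟦counits⟧-replicate (suc n) = refl , ⟦counits⟧-replicate n

bigAnd≡true⇔ : ∀ {m} (φ : Clause m) (s : Vec Bool m) →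
               bigAnd φ s ≡ true ⇔ (∀ j → lookup φ j ≡ inside → lookup s j ≡ true)
bigAnd≡true⇔ [] [] = mk⇔ (λ _ ()) (λ _ → refl)
bigAnd≡true⇔ (inside ∷ φ) (x ∷ s) = mk⇔
  (λ e → let x≡true , rest = to ∧-true⇔ e in λ { zero _ → x≡true ; (suc j) → to (bigAnd≡true⇔ φ s) rest j })
  (λ H → from ∧-true⇔ (H zero refl , from (bigAnd≡true⇔ φ s) (H ∘ suc)))
bigAnd≡true⇔ (outside ∷ φ) (x ∷ s) = mk⇔
  (λ e → λ { zero () ; (suc j) → to (bigAnd≡true⇔ φ s) e j })
  (λ H → from (bigAnd≡true⇔ φ s) (H ∘ suc))

lookup-Φ : ∀ {m n} (A : Fin n → Fin m → Bool) i j → lookup (Φ A i) j ≡ A i j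
lookup-Φ A i zero with A i zero
... | true  = refl
... | false = refl
lookup-Φ A i (suc j) = lookup-Φ (λ i j → A i (suc j)) i j

matrix≡true⇔ : ∀ {m k n} (c₁ : CopyD m k) (c₂ : ConjD k n) i j →
               matrix c₁ c₂ i j ≡ true ⇔ ∃ λ w → src c₁ w ≡ j × tgt c₂ w ≡ i
matrix≡true⇔ {k = k} c₁ c₂ i j = mk⇔
  (λ e → let w , connected = satisfied (any⁻ joins (allFin k) (from T-≡ e))
             src≡j , tgt≡i = to (T-∧ {⌊ src c₁ w ≟ j ⌋}) connected
         in w , toWitness src≡j , toWitness tgt≡i)
  (λ { (w , refl , refl) → to T-≡ (any⁺ joins (lose (∈-allFin w)
         (from (T-∧ {⌊ src c₁ w ≟ src c₁ w ⌋}) (fromWitness refl , fromWitness refl)))) })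
  where
  joins : Fin k → Bool
  joins w = ⌊ src c₁ w ≟ j ⌋ ∧ ⌊ tgt c₂ w ≟ i ⌋

clause≡true⇔ : ∀ {m k n} (c₁ : CopyD m k) (c₂ : ConjD k n) s i →
               bigAnd (Φ (matrix c₁ c₂) i) s ≡ true ⇔ InputsTrue c₂ (lookup s ∘ src c₁) i
clause≡true⇔ c₁ c₂ s i = mk⇔
  (λ e w tgt≡i → to (bigAnd≡true⇔ (Φ (matrix c₁ c₂) i) s) e (src c₁ w) (connected (w , refl , tgt≡i)))
  (λ H → from (bigAnd≡true⇔ (Φ (matrix c₁ c₂) i) s) λ j inΦ →
    let w , src≡j , tgt≡i = to (matrix≡true⇔ c₁ c₂ i j) (trans (≡-sym (lookup-Φ (matrix c₁ c₂) i j)) inΦ)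
    in subst (λ j → lookup s j ≡ true) src≡j (H w tgt≡i))
  where
  connected : ∀ {j} → (∃ λ w → src c₁ w ≡ j × tgt c₂ w ≡ i) → lookup (Φ (matrix c₁ c₂) i) j ≡ inside
  connected p = trans (lookup-Φ (matrix c₁ c₂) i _) (from (matrix≡true⇔ c₁ c₂ i _) p)

mainTheorem9 : ∀ {m k n} (c₁ : CopyD m k) (c₂ : ConjD k n) (s : Vec Bool m) →
    ⟦ preNormal c₁ c₂ ⟧ s [] ⇔ SatisfiesAll s (Φ (matrix c₁ c₂))
mainTheorem9 {n = n} c₁ c₂ s = mk⇔ sound complete
  where
  sound : ⟦ preNormal c₁ c₂ ⟧ s [] → SatisfiesAll s (Φ (matrix c₁ c₂))
  sound (y , (z , s→z , z→y) , y≡false) i = Bool.¬-not λ violated →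
    let yᵢ≡true = ⟦embConj⟧⇒conjRel c₂ z→y i
                    (inputsTrue-mono c₂ (⟦embCopy⟧⇒copyRel c₁ s→z) (to (clause≡true⇔ c₁ c₂ s i) violated))
    in Bool.not-¬ yᵢ≡true (⟦counits⟧⇒false n y≡false i)

  complete : SatisfiesAll s (Φ (matrix c₁ c₂)) → ⟦ preNormal c₁ c₂ ⟧ s []
  complete sat = replicate n false
               , (pull c₁ s , copyRel⇒⟦embCopy⟧ c₁ (copyRel-pull c₁ s) , conjRel⇒⟦embConj⟧ c₂ noneFire)
               , ⟦counits⟧-replicate n
    where
    noneFire : ConjRel c₂ (pull c₁ s) (replicate n false)
    noneFire i H = ⊥-elim (Bool.not-¬ (from (clause≡true⇔ c₁ c₂ s i) (inputsTrue-mono c₂ pull≤ H)) (sat i))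
      where
      pull≤ : ∀ w → lookup (pull c₁ s) w ≤ lookup s (src c₁ w)
      pull≤ w = Bool.≤-reflexive (lookup-pull c₁ s w)
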